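{- Let $M=M_{n,k}=(m_{i,j})_{0\le i,j\le n-1}$ be the cyclic $(n,k)$-matrix, and define $M_r=(m_{i,n-1-j})$ (reversal of each row) and $M_c=(m_{n-1-i,j})$ (reversal of each column), with $M_{rc}=(M_r)_c$ and $M_{cr}=(M_c)_r$. Then (i) $M_c=M_r$; (ii) $M_{cr}=M_{rc}=M$; (iii) $(M^T)_r=(M_r)^T$ and $(M^T)_c=(M_c)^T$; (iv) $(M^T)_{rc}=M^T$.
   Context: The cyclic $(n,k)$-matrix ($n\ge1$, $0\le k\le n$) is $M_{n,k}=(m_{i,j})_{0\le i,j\le n-1}$ with $m_{i,j}=1$ iff $j\equiv ik+a\pmod n$ for some $0\le a\le k-1$, and $m_{i,j}=0$ otherwise. -}

module Defs where

open import Data.Nat using (ℕ; zero; suc; _+_; _*_; NonZero)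
open import Data.Nat.DivMod using (_%_)
open import Data.Fin using (Fin; toℕ; opposite)
open import Data.Fin.Properties using (any?)
open import Data.Product using (∃)
open import Relation.Binary.PropositionalEquality using (_≡_)
open import Relation.Nullary using (Dec; yes; no)
import Data.Nat.Properties as ℕP

Matrix : ℕ → Set
Matrix n = Fin n → Fin n → ℕ

-- j ≡ i*k + a (mod n) for some 0 ≤ a ≤ k-1.  Since 0 ≤ j < n, the congruence
-- j ≡ x (mod n) is exactly toℕ j ≡ x % n (n ≥ 1).
CyclicEntry : (n k : ℕ) → .{{_ : NonZero n}} → Fin n → Fin n → Set
CyclicEntry n k i j = ∃ λ (a : Fin k) → toℕ j ≡ (toℕ i * k + toℕ a) % n

cyclicEntry? : (n k : ℕ) → .{{_ : NonZero n}} → (i j : Fin n) → Dec (CyclicEntry n k i j)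
cyclicEntry? n k i j = any? (λ a → toℕ j ℕP.≟ (toℕ i * k + toℕ a) % n)

cyclicMatrix : (n k : ℕ) → .{{_ : NonZero n}} → Matrix n
cyclicMatrix n k i j with cyclicEntry? n k i j
... | yes _ = 1
... | no _  = 0

_ᵀ : ∀ {n} → Matrix n → Matrix n
(M ᵀ) i j = M j i

-- Row reversal M_r = (m_{i,n-1-j});  opposite j has toℕ = n-1-toℕ j.
rowRev : ∀ {n} → Matrix n → Matrix n
rowRev M i j = M i (opposite j)

colRev : ∀ {n} → Matrix n → Matrix n
colRev M i j = M (opposite i) j

_≐_ : ∀ {n} → Matrix n → Matrix n → Set
A ≐ B = ∀ i j → A i j ≡ B i j

infix 4 _≐_
infixl 30 _ᵀ

-- M_{n,k} is centrosymmetric: reversing rows and columns together maps the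
-- relation j ≡ ik + a (mod n) to n-1-j ≡ (n-1-i)k + (k-1-a) (mod n), because
-- the two right-hand sides add up to nk - 1. Every claim of the proposition
-- is then a formal consequence of centrosymmetry and of opposite being an
-- involution.
module Submission where

open import Defs
open import Data.Nat using (ℕ; suc; _+_; _*_; _∸_; _≤_; s≤s; z≤n; NonZero)
open import Data.Nat.Properties using (m∸n+n≡m; ∸-monoʳ-<; +-suc; *-comm)
open import Data.Nat.DivMod using (_%_; _/_; m≡m%n+[m/n]*n; m%n<n; [m+kn]%n≡m%n; m<n⇒m%n≡m)
open import Data.Nat.Tactic.RingSolver using (solve-∀)
open import Data.Fin using (Fin; toℕ; opposite)
open import Data.Fin.Properties using (opposite-prop; opposite-involutive; toℕ<n)
open import Data.Product using (_×_; _,_)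
open import Data.Empty using (⊥-elim)
open import Relation.Nullary using (yes; no)
open import Relation.Binary.PropositionalEquality
  using (_≡_; refl; sym; trans; cong; cong₂; subst₂; module ≡-Reasoning)

open ≡-Reasoning

%-complement : ∀ n .{{_ : NonZero n}} x y c → x + suc y ≡ c * n →
               x % n ≡ n ∸ suc (y % n)
%-complement n x y c x+1+y≡cn = begin
  x % n                   ≡⟨ [m+kn]%n≡m%n x (suc q) n ⟨
  (x + suc q * n) % n     ≡⟨ cong (_% n) shift ⟨
  (n ∸ suc r + c * n) % n ≡⟨ [m+kn]%n≡m%n (n ∸ suc r) c n ⟩
  (n ∸ suc r) % n         ≡⟨ m<n⇒m%n≡m (∸-monoʳ-< (s≤s z≤n) (m%n<n y n)) ⟩
  n ∸ suc r               ∎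
  where
  r q : ℕ
  r = y % n
  q = y / n
  regroup : ∀ d x r Q → d + (x + suc (r + Q)) ≡ x + ((d + suc r) + Q)
  regroup = solve-∀
  shift : n ∸ suc r + c * n ≡ x + suc q * n
  shift = begin
    n ∸ suc r + c * n                 ≡⟨ cong (n ∸ suc r +_) x+1+y≡cn ⟨
    n ∸ suc r + (x + suc y)           ≡⟨ cong (λ y′ → n ∸ suc r + (x + suc y′)) (m≡m%n+[m/n]*n y n) ⟩
    n ∸ suc r + (x + suc (r + q * n)) ≡⟨ regroup (n ∸ suc r) x r (q * n) ⟩
    x + ((n ∸ suc r + suc r) + q * n) ≡⟨ cong (λ m → x + (m + q * n)) (m∸n+n≡m (m%n<n y n)) ⟩
    x + suc q * n                     ∎

opposite-cyclicEntry : ∀ n k .{{_ : NonZero n}} {i j : Fin n} →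
                       CyclicEntry n k i j → CyclicEntry n k (opposite i) (opposite j)
opposite-cyclicEntry n k {i} {j} (a , j≡ik+a) = opposite a , (begin
  toℕ (opposite j)                         ≡⟨ opposite-prop j ⟩
  n ∸ suc (toℕ j)                          ≡⟨ cong (λ m → n ∸ suc m) j≡ik+a ⟩
  n ∸ suc ((toℕ i * k + toℕ a) % n)        ≡⟨ %-complement n _ _ k complements ⟨
  (p * k + r) % n                          ≡⟨ cong (_% n) (cong₂ (λ u v → u * k + v)
                                                (opposite-prop i) (opposite-prop a)) ⟨
  (toℕ (opposite i) * k + toℕ (opposite a)) % n ∎)
  where
  p r : ℕ
  p = n ∸ suc (toℕ i)
  r = k ∸ suc (toℕ a)
  regroup : ∀ p r i a k → p * k + r + suc (i * k + a) ≡ (r + suc a) + (p + i) * k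
  regroup = solve-∀
  complements : p * k + r + suc (toℕ i * k + toℕ a) ≡ k * n
  complements = begin
    p * k + r + suc (toℕ i * k + toℕ a) ≡⟨ regroup p r (toℕ i) (toℕ a) k ⟩
    (r + suc (toℕ a)) + (p + toℕ i) * k ≡⟨ cong (_+ (p + toℕ i) * k) (m∸n+n≡m (toℕ<n a)) ⟩
    suc (p + toℕ i) * k                 ≡⟨ cong (_* k) (+-suc p (toℕ i)) ⟨
    (p + suc (toℕ i)) * k               ≡⟨ cong (_* k) (m∸n+n≡m (toℕ<n i)) ⟩
    n * k                               ≡⟨ *-comm n k ⟩
    k * n                               ∎

Centrosymmetric : ∀ {n} → Matrix n → Set
Centrosymmetric M = colRev (rowRev M) ≐ M

cyclicMatrix-centrosymmetric : ∀ n k .{{_ : NonZero n}} → Centrosymmetric (cyclicMatrix n k)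
cyclicMatrix-centrosymmetric n k i j
  with cyclicEntry? n k (opposite i) (opposite j) | cyclicEntry? n k i j
... | yes _  | yes _  = refl
... | no _   | no _   = refl
... | yes e′ | no ¬e  = ⊥-elim (¬e (subst₂ (CyclicEntry n k)
                          (opposite-involutive i) (opposite-involutive j)
                          (opposite-cyclicEntry n k e′)))
... | no ¬e′ | yes e  = ⊥-elim (¬e′ (opposite-cyclicEntry n k e))

module CentrosymmetricProperties {n} {M : Matrix n} (cs : Centrosymmetric M) where

  colRev≐rowRev : colRev M ≐ rowRev M
  colRev≐rowRev i j = trans (cong (M (opposite i)) (sym (opposite-involutive j))) (cs i (opposite j))

  rowRev-ᵀ : rowRev (M ᵀ) ≐ (rowRev M) ᵀ
  rowRev-ᵀ i j = colRev≐rowRev j i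

  colRev-ᵀ : colRev (M ᵀ) ≐ (colRev M) ᵀ
  colRev-ᵀ i j = sym (colRev≐rowRev j i)

  ᵀ-centrosymmetric : Centrosymmetric (M ᵀ)
  ᵀ-centrosymmetric i j = cs j i

proposition4p3 : (n k : ℕ) → .{{_ : NonZero n}} → k ≤ n →
    let M = cyclicMatrix n k in
      (colRev M ≐ rowRev M)
    × (rowRev (colRev M) ≐ M)
    × (colRev (rowRev M) ≐ M)
    × (rowRev (M ᵀ) ≐ (rowRev M) ᵀ)
    × (colRev (M ᵀ) ≐ (colRev M) ᵀ)
    × (colRev (rowRev (M ᵀ)) ≐ M ᵀ)
proposition4p3 n k _ = colRev≐rowRev , cs , cs , rowRev-ᵀ , colRev-ᵀ , ᵀ-centrosymmetric
  where
  cs : Centrosymmetric (cyclicMatrix n k)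
  cs = cyclicMatrix-centrosymmetric n k
  open CentrosymmetricProperties cs
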